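{- Let $A$ be a set, $\mu\le\lambda$ cardinals, and $\mathbf a,\mathbf b,\mathbf c\in(\lambda)^{<\mu}$ with $\mathbf b\subseteq\mathbf c$. Let $X\subseteq{}^{\mathrm{otp}(\mathbf c)}A$ be full over $\mathbf b$ and $Y\subseteq{}^{\mathrm{otp}(\mathbf a)}A$ such that $(\pi^{\mathbf c}_{\mathbf a\cap\mathbf c})^{ -1}\pi^{\mathbf a}_{\mathbf a\cap\mathbf c}Y\subseteq X$. Let $Y^+$ be the fullification of $Y$ over $\mathbf a\cap\mathbf b$. Then (1) $(\pi^{\mathbf c}_{\mathbf a\cap\mathbf c})^{ -1}\pi^{\mathbf a}_{\mathbf a\cap\mathbf c}Y^+\subseteq X$; and (2) $\pi^{\mathbf a}_{\mathbf a\cap\mathbf c}Y^+$ is full over $\mathbf a\cap\mathbf b$.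
   Context: $(\lambda)^{<\mu}$ is the set of subsets of $\lambda$ of order type $<\mu$. For $\mathbf d\subseteq\mathbf e$, $p_{\mathbf d,\mathbf e}:\mathrm{otp}(\mathbf d)\to\mathrm{otp}(\mathbf e)$ is the unique order-preserving map such that the $i$-th member of $\mathbf d$ is the $p_{\mathbf d,\mathbf e}(i)$-th member of $\mathbf e$, and $\pi^{\mathbf e}_{\mathbf d}:{}^{\mathrm{otp}(\mathbf e)}A\to{}^{\mathrm{otp}(\mathbf d)}A$ is $s\mapsto s\circ p_{\mathbf d,\mathbf e}$; for sets, $\pi^{\mathbf e}_{\mathbf d}Z$ is the image and $(\pi^{\mathbf e}_{\mathbf d})^{ -1}Z$ the preimage. $Z\subseteq{}^{\mathrm{otp}(\mathbf e)}A$ is full over $\mathbf d$ iff $\pi^{\mathbf e}_{\mathbf d}(s)=\pi^{\mathbf e}_{\mathbf d}(t)$ implies ($s\in Z\iff t\in Z$). The fullification of $Z$ over $\mathbf d$ is the smallest superset of $Z$ that is full over $\mathbf d$, namely $(\pi^{\mathbf e}_{\mathbf d})^{ -1}\pi^{\mathbf e}_{\mathbf d}Z$. -}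

module Defs where

open import Data.Bool using (Bool; true; false; T; _∧_)
open import Data.Product using (Σ; _×_; _,_)
open import Relation.Binary.PropositionalEquality using (_≡_)

-- Index set λ is modelled by an arbitrary type L; a subset d of λ is a
-- (classically decidable) characteristic function L → Bool.
Subset : Set → Set
Subset L = L → Bool

_∩_ : {L : Set} → Subset L → Subset L → Subset L
(a ∩ b) x = a x ∧ b x

_⊆_ : {L : Set} → Subset L → Subset L → Set
_⊆_ {L} d e = (x : L) → T (d x) → T (e x)

-- Sequences of length otp(d) into A, indexed through the canonical order
-- isomorphism otp(d) ≅ d: a sequence assigns to each member of d a value in A.
Seq : {L : Set} → Set → Subset L → Set
Seq {L} A d = (x : L) → T (d x) → A

_≈_ : {L A : Set} {d : Subset L} → Seq A d → Seq A d → Set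
_≈_ {L} {d = d} s t = (x : L) (h : T (d x)) → s x h ≡ t x h

π : {L A : Set} {d e : Subset L} → d ⊆ e → Seq A e → Seq A d
π d⊆e s x h = s x (d⊆e x h)

Pred : {L : Set} → Set → Subset L → Set₁
Pred A d = Seq A d → Set

_⊑_ : {L A : Set} {d : Subset L} → Pred A d → Pred A d → Set
_⊑_ {A = A} {d} Z W = (s : Seq A d) → Z s → W s

Img : {L A : Set} {d e : Subset L} → d ⊆ e → Pred A e → Pred A d
Img {A = A} {e = e} p Z u = Σ (Seq A e) λ s → Z s × (π p s ≈ u)

Pre : {L A : Set} {d e : Subset L} → d ⊆ e → Pred A d → Pred A e
Pre p W t = W (π p t)

Full : {L A : Set} {d e : Subset L} → d ⊆ e → Pred A e → Set
Full {A = A} {e = e} p Z =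
  (s t : Seq A e) → π p s ≈ π p t → (Z s → Z t) × (Z t → Z s)

Fullification : {L A : Set} {d e : Subset L} → d ⊆ e → Pred A e → Pred A e
Fullification p Z = Pre p (Img p Z)

∩⊆ˡ : {L : Set} (a b : Subset L) → (a ∩ b) ⊆ a
∩⊆ˡ a b x h with a x | b x
... | true | true = h

∩⊆ʳ : {L : Set} (a b : Subset L) → (a ∩ b) ⊆ b
∩⊆ʳ a b x h with a x | b x
... | true | true = h

∩-monoʳ : {L : Set} (a : Subset L) {b c : Subset L} → b ⊆ c → (a ∩ b) ⊆ (a ∩ c)
∩-monoʳ a {b} {c} b⊆c x h with a x | b x | b⊆c x
... | true | true | f with c x | f _
...   | true | _ = _

-- Both parts are amalgamation arguments. For (1): a point t of the left side
-- comes with s' ∈ Y agreeing with t on a ∩ b; overwrite t on a ∩ c by s'. The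
-- result lies in X by hypothesis and agrees with t on b ⊆ c, so t ∈ X because
-- X is full over b. For (2): if v agrees on a ∩ b with π u for some u ∈ Y⁺,
-- overwrite u on a ∩ c by v. The result still agrees with u on a ∩ b, hence
-- lies in Y⁺, and it restricts to v.
module Submission where

open import Defs
open import Data.Bool using (T)
open import Data.Bool.Properties using (T-irrelevant; T-∧)
open import Data.Product using (_×_; _,_; proj₁)
open import Function.Bundles using (Equivalence)
open import Relation.Nullary using (yes; no; contradiction)
open import Relation.Nullary.Decidable using (T?)
open import Relation.Binary.PropositionalEquality using (_≡_; refl; sym; trans; cong; module ≡-Reasoning)

open Equivalence using (to; from)

module _ {L A : Set} where

  seq-irrelevant : {d : Subset L} (s : Seq A d) {x : L} {h h′ : T (d x)} → s x h ≡ s x h′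
  seq-irrelevant s = cong (s _) (T-irrelevant _ _)

  ≈-sym : {d : Subset L} {s t : Seq A d} → s ≈ t → t ≈ s
  ≈-sym s≈t x h = sym (s≈t x h)

  ≈-trans : {d : Subset L} {s t u : Seq A d} → s ≈ t → t ≈ u → s ≈ u
  ≈-trans s≈t t≈u x h = trans (s≈t x h) (t≈u x h)

  closed⇒Full : {d e : Subset L} (p : d ⊆ e) {Z : Pred A e}
    → ((s t : Seq A e) → π p s ≈ π p t → Z s → Z t) → Full p Z
  closed⇒Full p closed s t s≈t = closed s t s≈t , closed t s (≈-sym s≈t)

  patch : (d : Subset L) {e : Subset L} → Seq A e → Seq A d → Seq A e
  patch d s u x h with T? (d x)
  ... | yes hd = u x hd
  ... | no _   = s x h

  π-patch : {d e : Subset L} (p : d ⊆ e) (s : Seq A e) (u : Seq A d)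
    → π p (patch d s u) ≈ u
  π-patch {d} p s u x hd with T? (d x)
  ... | yes _   = seq-irrelevant u
  ... | no ¬hd  = contradiction hd ¬hd

  π-patch-unchanged : {d e f : Subset L} (q : f ⊆ e) (s : Seq A e) (u : Seq A d)
    → ((x : L) (hf : T (f x)) (hd : T (d x)) → s x (q x hf) ≡ u x hd)
    → π q (patch d s u) ≈ π q s
  π-patch-unchanged {d} q s u agree x hf with T? (d x)
  ... | yes hd = sym (agree x hf hd)
  ... | no _   = refl

module _ {L A : Set} (a b c : Subset L) (b⊆c : b ⊆ c) where

  preimage-image-fullification-⊑ : (X : Pred A c) (Y : Pred A a)
    → Full b⊆c X
    → Pre (∩⊆ʳ a c) (Img (∩⊆ˡ a c) Y) ⊑ X
    → Pre (∩⊆ʳ a c) (Img (∩⊆ˡ a c) (Fullification (∩⊆ˡ a b) Y)) ⊑ X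
  preimage-image-fullification-⊑ X Y fullX preimage⊑X t (s , (s′ , Ys′ , s′≈s) , s≈t) =
    proj₁ (fullX t′ t (π-patch-unchanged b⊆c t (π (∩⊆ˡ a c) s′) agree)) Xt′
    where
    t′ : Seq A c
    t′ = patch (a ∩ c) t (π (∩⊆ˡ a c) s′)

    Xt′ : X t′
    Xt′ = preimage⊑X t′ (s′ , Ys′ , ≈-sym (π-patch (∩⊆ʳ a c) t (π (∩⊆ˡ a c) s′)))

    agree : (x : L) (hb : T (b x)) (hac : T ((a ∩ c) x))
      → t x (b⊆c x hb) ≡ s′ x (∩⊆ˡ a c x hac)
    agree x hb hac = begin
      t x (b⊆c x hb)          ≡⟨ seq-irrelevant t ⟩
      t x (∩⊆ʳ a c x hac)     ≡⟨ sym (s≈t x hac) ⟩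
      s x (∩⊆ˡ a c x hac)     ≡⟨ seq-irrelevant s ⟩
      s x (∩⊆ˡ a b x hab)     ≡⟨ sym (s′≈s x hab) ⟩
      s′ x (∩⊆ˡ a b x hab)    ≡⟨ seq-irrelevant s′ ⟩
      s′ x (∩⊆ˡ a c x hac)    ∎
      where
      open ≡-Reasoning
      hab : T ((a ∩ b) x)
      hab = from T-∧ (proj₁ (to T-∧ hac) , hb)

  image-fullification-Full : (Y : Pred A a)
    → Full (∩-monoʳ a b⊆c) (Img (∩⊆ˡ a c) (Fullification (∩⊆ˡ a b) Y))
  image-fullification-Full Y = closed⇒Full (∩-monoʳ a b⊆c) closed
    where
    closed : (u v : Seq A (a ∩ c)) → π (∩-monoʳ a b⊆c) u ≈ π (∩-monoʳ a b⊆c) v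
      → Img (∩⊆ˡ a c) (Fullification (∩⊆ˡ a b) Y) u
      → Img (∩⊆ˡ a c) (Fullification (∩⊆ˡ a b) Y) v
    closed u v u≈v (s , (s′ , Ys′ , s′≈s) , s≈u) =
      patch (a ∩ c) s v
      , (s′ , Ys′ , ≈-trans s′≈s (≈-sym (π-patch-unchanged (∩⊆ˡ a b) s v agree)))
      , π-patch (∩⊆ˡ a c) s v
      where
      agree : (x : L) (hab : T ((a ∩ b) x)) (hac : T ((a ∩ c) x))
        → s x (∩⊆ˡ a b x hab) ≡ v x hac
      agree x hab hac = begin
        s x (∩⊆ˡ a b x hab)           ≡⟨ seq-irrelevant s ⟩
        s x (∩⊆ˡ a c x hac)           ≡⟨ s≈u x hac ⟩
        u x hac                       ≡⟨ seq-irrelevant u ⟩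
        u x (∩-monoʳ a b⊆c x hab)     ≡⟨ u≈v x hab ⟩
        v x (∩-monoʳ a b⊆c x hab)     ≡⟨ seq-irrelevant v ⟩
        v x hac                       ∎
        where open ≡-Reasoning

mainTheorem7 : {L A : Set} (a b c : Subset L) (b⊆c : b ⊆ c)
    (X : Pred A c) (Y : Pred A a)
    → Full b⊆c X
    → Pre (∩⊆ʳ a c) (Img (∩⊆ˡ a c) Y) ⊑ X
    → (Pre (∩⊆ʳ a c) (Img (∩⊆ˡ a c) (Fullification (∩⊆ˡ a b) Y)) ⊑ X)
    × Full (∩-monoʳ a b⊆c) (Img (∩⊆ˡ a c) (Fullification (∩⊆ˡ a b) Y))
mainTheorem7 a b c b⊆c X Y fullX preimage⊑X =
  preimage-image-fullification-⊑ a b c b⊆c X Y fullX preimage⊑X ,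
  image-fullification-Full a b c b⊆c Y
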